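{- For every $n\ge1$, the poset $(\mathcal E_n,\le_C)$ is isomorphic to the poset $(\mathcal P_n,\preceq)$.
   Context: An $(n,n)$-clan is a string $\gamma=c_1\cdots c_{2n}$ of symbols from $\mathbb{N}\cup\{+,-\}$ such that each natural number appearing appears exactly twice and the numbers of $+$'s and $-$'s are equal; clans are equal if they have the same $\pm$ symbols in the same positions and the same sets of positions of matching pairs. $\gamma$ is skew-symmetric if $\gamma=-rev(\gamma)$, where $rev$ reverses the string and $-$ interchanges $+$ and $-$. The base clan of $\gamma$ is obtained by replacing, for each matching pair $c_i=c_j\in\mathbb N$ with $i<j$, the symbol $c_i$ by $-$ and $c_j$ by $+$. $\mathcal E_n$ is the set of skew-symmetric $(n,n)$-clans with base clan $\underbrace{ -\cdots- }_{n}\underbrace{+\cdots+}_{n}$. For a clan $\gamma=c_1\cdots c_{2n}$ and $1\le i<j\le 2n$: $\gamma(i;+)$ is the number of $+$ signs plus the number of pairs of equal natural numbers both occurring among $c_1\cdots c_i$; $\gamma(i;-)$ is the number of $-$ signs plus the number of pairs of equal natural numbers both occurring among $c_1\cdots c_i$; $\gamma(i;j)$ is the number of pairs $c_s=c_t\in\mathbb N$ with $s\le i<j<t$. The conjectural $CI$ Bruhat order $\le_C$ on skew-symmetric $(n,n)$-clans is the restriction of the closure order on all $(n,n)$-clans (closure order of $GL_n\times GL_n$-orbits in the flag variety of $GL_{2n}$), which by a theorem of Wyser is: $\gamma\le_C\tau$ iff for all $i$ and all $i<j$: $\gamma(i;+)\ge\tau(i;+)$, $\gamma(i;-)\ge\tau(i;-)$,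 and $\gamma(i;j)\le\tau(i;j)$. $\mathcal P_n$ is the set of partial involutions on $n$ letters, i.e. symmetric $n\times n$ $0/1$ matrices with at most one $1$ in each row and column. For such a matrix $\pi$ and $1\le k,l\le n$, let $\pi_{k,l}$ be its upper-left $k\times l$ submatrix; $\pi\preceq\sigma$ iff $\mathrm{rank}(\pi_{k,l})\le\mathrm{rank}(\sigma_{k,l})$ for all $k,l$. -}

module Defs where

open import Data.Nat using (ℕ; zero; suc; _+_; _≤_; _<_; _<ᵇ_; _≤ᵇ_)
open import Data.Fin using (Fin; toℕ; opposite)
import Data.Fin as F
open import Data.Bool using (Bool; true; false; _∧_; if_then_else_)
open import Data.Product using (Σ; _×_; proj₁)
open import Relation.Binary.PropositionalEquality using (_≡_; _≢_)
open import Level using (Level; _⊔_)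
open import Function.Bundles using (_⇔_)

sumF : ∀ {m} → (Fin m → ℕ) → ℕ
sumF {zero}  f = 0
sumF {suc m} f = f F.zero + sumF (λ i → f (F.suc i))

countF : ∀ {m} → (Fin m → Bool) → ℕ
countF p = sumF (λ i → if p i then 1 else 0)

-- A symbol is +, -, or a natural number; since clans
-- are equal iff they have the same ± symbols at the same positions and
-- the same sets of positions of matching pairs, a natural-number symbol
-- at position i is recorded by the position of its (unique) partner.

data Sym (m : ℕ) : Set where
  plus minus : Sym m
  pair       : Fin m → Sym m

record Clan (m : ℕ) : Set where
  field
    sym        : Fin m → Sym m
    pair-irr   : ∀ i j → sym i ≡ pair j → i ≢ j
    pair-sym   : ∀ i j → sym i ≡ pair j → sym j ≡ pair i
open Clan public

isPlus : ∀ {m} → Sym m → Bool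
isPlus plus = true
isPlus _    = false

isMinus : ∀ {m} → Sym m → Bool
isMinus minus = true
isMinus _     = false

IsNNClan : (n : ℕ) → Clan (n + n) → Set
IsNNClan n γ = countF (λ i → isPlus (sym γ i)) ≡ countF (λ i → isMinus (sym γ i))

negRevSym : ∀ {m} → Sym m → Sym m
negRevSym plus     = minus
negRevSym minus    = plus
negRevSym (pair j) = pair (opposite j)

SkewSymmetric : ∀ {m} → Clan m → Set
SkewSymmetric γ = ∀ i → sym γ i ≡ negRevSym (sym γ (opposite i))

baseSym : ∀ {m} → Fin m → Sym m → Sym m
baseSym i plus     = plus
baseSym i minus    = minus
baseSym i (pair j) = if toℕ i <ᵇ toℕ j then minus else plus

HasStandardBase : (n : ℕ) → Clan (n + n) → Set
HasStandardBase n γ = ∀ i → baseSym i (sym γ i) ≡ (if toℕ i <ᵇ n then minus else plus)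

record En (n : ℕ) : Set where
  field
    clan : Clan (n + n)
    nn   : IsNNClan n clan
    skew : SkewSymmetric clan
    base : HasStandardBase n clan
open En public

_≈E_ : ∀ {n} → En n → En n → Set
γ ≈E τ = ∀ i → sym (clan γ) i ≡ sym (clan τ) i

-- Wyser's statistics (positions i, j are 1-based as in the paper;
-- Fin positions t are 0-based, so position t is among c_1..c_i iff toℕ t < i)

closesWith : ∀ {m} → (ℕ → Bool) → Fin m → Sym m → Bool
closesWith c t (pair s) = (toℕ s <ᵇ toℕ t) ∧ c (toℕ s)
closesWith c t _        = false

pairsUpTo : ∀ {m} → Clan m → ℕ → ℕ
pairsUpTo γ i = countF (λ t → closesWith (λ _ → true) t (sym γ t) ∧ (toℕ t <ᵇ i))

plusCount : ∀ {m} → Clan m → ℕ → ℕ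
plusCount γ i = countF (λ t → isPlus (sym γ t) ∧ (toℕ t <ᵇ i)) + pairsUpTo γ i

minusCount : ∀ {m} → Clan m → ℕ → ℕ
minusCount γ i = countF (λ t → isMinus (sym γ t) ∧ (toℕ t <ᵇ i)) + pairsUpTo γ i

-- γ(i;j): pairs c_s = c_t with s ≤ i < j < t  (1-based)
crossCount : ∀ {m} → Clan m → ℕ → ℕ → ℕ
crossCount γ i j = countF (λ t → closesWith (λ s → s <ᵇ i) t (sym γ t) ∧ (j ≤ᵇ toℕ t))

-- closure (Bruhat) order on (n,n)-clans, Wyser's criterion
_≤W_ : ∀ {m} → Clan m → Clan m → Set
_≤W_ {m} γ τ =
  (∀ i → 1 ≤ i → i ≤ m → plusCount τ i ≤ plusCount γ i) ×
  (∀ i → 1 ≤ i → i ≤ m → minusCount τ i ≤ minusCount γ i) ×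
  (∀ i j → 1 ≤ i → i < j → j ≤ m → crossCount γ i j ≤ crossCount τ i j)

_≤C_ : ∀ {n} → En n → En n → Set
γ ≤C τ = clan γ ≤W clan τ

record PartialInvolution (n : ℕ) : Set where
  field
    mat     : Fin n → Fin n → Bool
    symm    : ∀ i j → mat i j ≡ mat j i
    rowOne  : ∀ i j k → mat i j ≡ true → mat i k ≡ true → j ≡ k
    colOne  : ∀ i j k → mat j i ≡ true → mat k i ≡ true → j ≡ k
open PartialInvolution public

_≈P_ : ∀ {n} → PartialInvolution n → PartialInvolution n → Set
π ≈P σ = ∀ i j → mat π i j ≡ mat σ i j

-- rank of the upper-left k×l submatrix π_{k,l}.  Every submatrix of a
-- partial permutation matrix is again a partial permutation matrix, whose
-- rank is its number of nonzero entries.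
rankUL : ∀ {n} → PartialInvolution n → ℕ → ℕ → ℕ
rankUL π k l = sumF (λ i → countF (λ j → mat π i j ∧ (toℕ i <ᵇ k) ∧ (toℕ j <ᵇ l)))

_≼_ : ∀ {n} → PartialInvolution n → PartialInvolution n → Set
_≼_ {n} π σ = ∀ k l → 1 ≤ k → k ≤ n → 1 ≤ l → l ≤ n → rankUL π k l ≤ rankUL σ k l

-- Isomorphism of posets whose carriers are taken up to an equivalence
-- (the equality of the underlying objects): mutually inverse,
-- equality-respecting maps f, g with  x ≤ y ⇔ f x ≤ f y.

record PosetIso {a b ℓ₁ ℓ₂ r₁ r₂ : Level}
  (A : Set a) (_≈A_ : A → A → Set ℓ₁) (_≤A_ : A → A → Set r₁)
  (B : Set b) (_≈B_ : B → B → Set ℓ₂) (_≤B_ : B → B → Set r₂)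
  : Set (a ⊔ b ⊔ ℓ₁ ⊔ ℓ₂ ⊔ r₁ ⊔ r₂) where
  field
    to        : A → B
    from      : B → A
    to-cong   : ∀ {x y} → x ≈A y → to x ≈B to y
    from-cong : ∀ {x y} → x ≈B y → from x ≈A from y
    from-to   : ∀ x → from (to x) ≈A x
    to-from   : ∀ y → to (from y) ≈B y
    mono      : ∀ x y → (x ≤A y) ⇔ (to x ≤B to y)

module Submission where

-- Each of the first n positions of a clan in E_n carries either − or the opener of a pair
-- whose closer lies in the second half, at the mirror image of some position b < n;
-- skew-symmetry then pairs b with the mirror image of a.  So γ ∈ E_n amounts to a partial
-- involution π (π a b = 1 iff a is paired with the mirror of b), and counting row by row,
-- γ(i;+) is the same for all γ, γ(i;−) = i − rank π_{i,n} for i ≤ n,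
-- γ(n+i;−) = n − rank π_{n−i,n}, and γ(i;j) = rank π_{2n−j,i}.  Hence Wyser's inequalities
-- for γ, τ are exactly the rank inequalities for their partial involutions.

open import Defs
open import Data.Nat using (ℕ; _≤_; zero; suc; _+_; _∸_; _<_; _<ᵇ_; _≤ᵇ_; _⊓_; z≤n; s≤s; _<?_; _≤?_)
open import Data.Nat.Properties
open import Data.Fin using (Fin; toℕ; opposite; _↑ˡ_; _↑ʳ_; splitAt; fromℕ; inject₁)
import Data.Fin as F
import Data.Fin.Properties as FP
open import Data.Fin.Properties using (any?)
open import Data.Bool using (Bool; true; false; _∧_; not; if_then_else_)
import Data.Bool as Bool
open import Data.Bool.Properties using (∧-comm; ∧-zeroʳ; ⇔→≡; T-≡)
open import Data.Maybe using (Maybe; just; nothing; is-just; is-nothing; maybe′)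
import Data.Maybe as Maybe
open import Data.Maybe.Properties using (just-injective)
import Data.Maybe.Properties as MaybeP
open import Data.Sum using (inj₁; inj₂; [_,_]′; isInj₁)
open import Data.Product using (∃; _,_; proj₁)
open import Data.Empty using (⊥-elim)
open import Function using (_∘_; const)
open import Function.Bundles using (_⇔_; mk⇔; Equivalence)
open import Function.Construct.Composition using (_⇔-∘_)
open import Relation.Nullary using (yes; no; Dec)
open import Relation.Nullary.Decidable using (does; dec-true; dec-false; does-⇔; ¬?; dec⇒maybe)
open import Relation.Binary.PropositionalEquality
  using (_≡_; _≢_; refl; trans; cong; cong₂; subst; subst₂; module ≡-Reasoning)
  renaming (sym to ≡-sym)

open Equivalence using (to; from)

private
  variable
    m n : ℕ

sumF-cong : {f g : Fin m → ℕ} → (∀ i → f i ≡ g i) → sumF f ≡ sumF g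
sumF-cong {zero}  e = refl
sumF-cong {suc m} e = cong₂ _+_ (e F.zero) (sumF-cong (e ∘ F.suc))

sumF-zero : {f : Fin m → ℕ} → (∀ i → f i ≡ 0) → sumF f ≡ 0
sumF-zero {zero}  e = refl
sumF-zero {suc m} e = cong₂ _+_ (e F.zero) (sumF-zero (e ∘ F.suc))

sumF-↑ : ∀ m (f : Fin (m + n) → ℕ) → sumF f ≡ sumF (λ a → f (a ↑ˡ n)) + sumF (λ c → f (m ↑ʳ c))
sumF-↑ zero    f = refl
sumF-↑ (suc m) f = trans (cong (f F.zero +_) (sumF-↑ m (f ∘ F.suc))) (≡-sym (+-assoc (f F.zero) _ _))

sumF-fromℕ : (f : Fin (suc m) → ℕ) → sumF f ≡ sumF (f ∘ inject₁) + f (fromℕ m)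
sumF-fromℕ {zero}  f = +-comm (f F.zero) 0
sumF-fromℕ {suc m} f = trans (cong (f F.zero +_) (sumF-fromℕ (f ∘ F.suc))) (≡-sym (+-assoc (f F.zero) _ _))

sumF-opposite : (f : Fin m → ℕ) → sumF f ≡ sumF (f ∘ opposite)
sumF-opposite {zero}  f = refl
sumF-opposite {suc m} f = begin
  sumF f                                       ≡⟨ sumF-fromℕ f ⟩
  sumF (f ∘ inject₁) + f (fromℕ m)             ≡⟨ cong (_+ f (fromℕ m)) (sumF-opposite (f ∘ inject₁)) ⟩
  sumF (f ∘ inject₁ ∘ opposite) + f (fromℕ m)  ≡⟨ +-comm _ (f (fromℕ m)) ⟩
  sumF (f ∘ opposite)                          ∎
  where open ≡-Reasoning

countF-cong : {p q : Fin m → Bool} → (∀ i → p i ≡ q i) → countF p ≡ countF q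
countF-cong e = sumF-cong (cong (if_then 1 else 0) ∘ e)

countF-false : {p : Fin m → Bool} → (∀ i → p i ≡ false) → countF p ≡ 0
countF-false e = sumF-zero (cong (if_then 1 else 0) ∘ e)

countF-true : countF {m} (const true) ≡ m
countF-true {zero}  = refl
countF-true {suc m} = cong suc countF-true

countF-<ᵇ : ∀ i → i ≤ m → countF {m} (λ a → toℕ a <ᵇ i) ≡ i
countF-<ᵇ {m}     zero    _         = countF-false {m} (λ _ → refl)
countF-<ᵇ {suc m} (suc i) (s≤s i≤m) = cong suc (countF-<ᵇ i i≤m)

countF-partition : (p q : Fin m → Bool) →
  countF (λ a → p a ∧ not (q a)) + countF (λ a → p a ∧ q a) ≡ countF p
countF-partition {zero}  p q = refl
countF-partition {suc m} p q with p F.zero | q F.zero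
... | false | _     = countF-partition (p ∘ F.suc) (q ∘ F.suc)
... | true  | false = cong suc (countF-partition (p ∘ F.suc) (q ∘ F.suc))
... | true  | true  = trans (+-suc _ _) (cong suc (countF-partition (p ∘ F.suc) (q ∘ F.suc)))

countF-≟ : (b₀ : Fin m) (q : Fin m → Bool) →
  countF (λ b → does (b₀ FP.≟ b) ∧ q b) ≡ (if q b₀ then 1 else 0)
countF-≟ {suc m} F.zero     q =
  trans (cong ((if q F.zero then 1 else 0) +_) (countF-false {m} (λ _ → refl))) (+-identityʳ _)
countF-≟ {suc m} (F.suc b₀) q = countF-≟ b₀ (q ∘ F.suc)

does≡true⇔ : ∀ {p} {P : Set p} (d : Dec P) → does d ≡ true ⇔ P
does≡true⇔ (yes p) = mk⇔ (const p) (const refl)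
does≡true⇔ (no ¬p) = mk⇔ (λ ()) (⊥-elim ∘ ¬p)

just-ext : {x y : Maybe (Fin n)} → (∀ b → x ≡ just b ⇔ y ≡ just b) → x ≡ y
just-ext {x = just b}                h = ≡-sym (to (h b) refl)
just-ext {x = nothing} {y = nothing} h = refl
just-ext {x = nothing} {y = just b}  h = from (h b) refl

<ᵇ-true : ∀ {x y} → x < y → (x <ᵇ y) ≡ true
<ᵇ-true = dec-true (_ <? _)

<ᵇ-false : ∀ {x y} → y ≤ x → (x <ᵇ y) ≡ false
<ᵇ-false y≤x = dec-false (_ <? _) (≤⇒≯ y≤x)

≤-∸-swap : ∀ {i j N} → i ≤ N → j ≤ N → i ≤ N ∸ j → j ≤ N ∸ i
≤-∸-swap {i} {j} {N} i≤N j≤N i≤N∸j =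
  m+n≤o⇒m≤o∸n j (subst (_≤ N) (+-comm i j) (m≤o∸n⇒m+n≤o i j≤N i≤N∸j))

≤ᵇ-∸-swap : ∀ {j y N} → j ≤ N → y < N → (j ≤ᵇ N ∸ suc y) ≡ (y <ᵇ N ∸ j)
≤ᵇ-∸-swap j≤N y<N = does-⇔ (mk⇔ (≤-∸-swap j≤N y<N) (≤-∸-swap y<N j≤N)) (_ ≤? _) (_ <? _)

∸-<ᵇ-swap : ∀ {k y N} → k ≤ N → y < N → (N ∸ suc y <ᵇ k) ≡ not (y <ᵇ N ∸ k)
∸-<ᵇ-swap k≤N y<N = does-⇔
  (mk⇔ (λ x<k y<N∸k → <⇒≱ x<k (≤-∸-swap y<N k≤N y<N∸k))
       (λ y≮N∸k → ≰⇒> (y≮N∸k ∘ ≤-∸-swap k≤N y<N)))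
  (_ <? _) (¬? (_ <? _))

≤-complement : ∀ {a b a′ b′ c} → a + b ≡ c → a′ + b′ ≡ c → a′ ≤ a ⇔ b ≤ b′
≤-complement {a} {b} {a′} {b′} e e′ = mk⇔
  (λ a′≤a → +-cancelˡ-≤ a′ b b′ (≤-trans (+-monoˡ-≤ b a′≤a) (≤-reflexive (trans e (≡-sym e′)))))
  (λ b≤b′ → +-cancelʳ-≤ b′ a′ a (≤-trans (≤-reflexive (trans e′ (≡-sym e))) (+-monoʳ-≤ a b≤b′)))

toℕ-opposite-↑ˡ : (a : Fin n) → toℕ (opposite (a ↑ˡ n)) ≡ n + n ∸ suc (toℕ a)
toℕ-opposite-↑ˡ {n} a = trans (FP.opposite-prop (a ↑ˡ n)) (cong (λ x → n + n ∸ suc x) (FP.toℕ-↑ˡ a n))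

opposite-↑ˡ : (a : Fin n) → opposite (a ↑ˡ n) ≡ n ↑ʳ opposite a
opposite-↑ˡ {n} a = FP.toℕ-injective (begin
  toℕ (opposite (a ↑ˡ n))  ≡⟨ toℕ-opposite-↑ˡ a ⟩
  n + n ∸ suc (toℕ a)      ≡⟨ +-∸-assoc n (FP.toℕ<n a) ⟩
  n + (n ∸ suc (toℕ a))    ≡⟨ cong (n +_) (FP.opposite-prop a) ⟨
  n + toℕ (opposite a)     ≡⟨ FP.toℕ-↑ʳ n (opposite a) ⟨
  toℕ (n ↑ʳ opposite a)    ∎)
  where open ≡-Reasoning

↑ˡ<n : (a : Fin n) → toℕ (a ↑ˡ n) < n
↑ˡ<n {n} a = subst (_< n) (≡-sym (FP.toℕ-↑ˡ a n)) (FP.toℕ<n a)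

n≤n+n∸suc : ∀ {a} → a < n → n ≤ n + n ∸ suc a
n≤n+n∸suc {n} a<n = m+n≤o⇒m≤o∸n n (+-monoʳ-≤ n a<n)

n≤opposite-↑ˡ : (a : Fin n) → n ≤ toℕ (opposite (a ↑ˡ n))
n≤opposite-↑ˡ {n} a = subst (n ≤_) (≡-sym (toℕ-opposite-↑ˡ a)) (n≤n+n∸suc (FP.toℕ<n a))

↑ˡ<opposite-↑ˡ : (a b : Fin n) → toℕ (a ↑ˡ n) < toℕ (opposite (b ↑ˡ n))
↑ˡ<opposite-↑ˡ a b = <-≤-trans (↑ˡ<n a) (n≤opposite-↑ˡ b)

↑ˡ≢opposite-↑ˡ : (a b : Fin n) → a ↑ˡ n ≢ opposite (b ↑ˡ n)
↑ˡ≢opposite-↑ˡ a b e = <-irrefl (cong toℕ e) (↑ˡ<opposite-↑ˡ a b)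

data Half (n : ℕ) : Fin (n + n) → Set where
  left  : (a : Fin n) → Half n (a ↑ˡ n)
  right : (a : Fin n) → Half n (opposite (a ↑ˡ n))

half : ∀ n (t : Fin (n + n)) → Half n t
half n t with splitAt n t in eq
... | inj₁ a = subst (Half n) (FP.splitAt⁻¹-↑ˡ eq) (left a)
... | inj₂ c = subst (Half n) mirror (right (opposite c))
  where
  mirror : opposite (opposite c ↑ˡ n) ≡ t
  mirror = trans (opposite-↑ˡ (opposite c))
    (trans (cong (n ↑ʳ_) (FP.opposite-involutive c)) (FP.splitAt⁻¹-↑ʳ eq))

countF-halves : (p : Fin (n + n) → Bool) →
  countF p ≡ countF (λ a → p (a ↑ˡ n)) + countF (λ a → p (opposite (a ↑ˡ n)))
countF-halves {n} p = begin
  countF p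
    ≡⟨ sumF-↑ n _ ⟩
  countF (λ a → p (a ↑ˡ n)) + countF (λ c → p (n ↑ʳ c))
    ≡⟨ cong (countF (λ a → p (a ↑ˡ n)) +_) (sumF-opposite (λ c → if p (n ↑ʳ c) then 1 else 0)) ⟩
  countF (λ a → p (a ↑ˡ n)) + countF (λ a → p (n ↑ʳ opposite a))
    ≡⟨ cong (countF (λ a → p (a ↑ˡ n)) +_) (countF-cong λ a → cong p (≡-sym (opposite-↑ˡ {n} a))) ⟩
  countF (λ a → p (a ↑ˡ n)) + countF (λ a → p (opposite (a ↑ˡ n)))  ∎
  where open ≡-Reasoning

-- The symbols at position a and at its mirror image when row a has its 1 in column b:
-- a is paired with the mirror of b, and the mirror of a with b.
leftSym : Maybe (Fin n) → Sym (n + n)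
leftSym     nothing  = minus
leftSym {n} (just b) = pair (opposite (b ↑ˡ n))

rightSym : Maybe (Fin n) → Sym (n + n)
rightSym     nothing  = plus
rightSym {n} (just b) = pair (b ↑ˡ n)

-- Junk value nothing for a pair whose partner lies in the first half.
column : Sym (n + n) → Maybe (Fin n)
column {n} (pair p) = isInj₁ (splitAt n (opposite p))
column     _        = nothing

column-leftSym : (x : Maybe (Fin n)) → column (leftSym x) ≡ x
column-leftSym     nothing  = refl
column-leftSym {n} (just b) rewrite FP.opposite-involutive (b ↑ˡ n) | FP.splitAt-↑ˡ n b n = refl

negRevSym-leftSym : (x : Maybe (Fin n)) → negRevSym (leftSym x) ≡ rightSym x
negRevSym-leftSym nothing  = refl
negRevSym-leftSym (just b) = cong pair (FP.opposite-involutive _)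

negRevSym-rightSym : (x : Maybe (Fin n)) → negRevSym (rightSym x) ≡ leftSym x
negRevSym-rightSym nothing  = refl
negRevSym-rightSym (just b) = refl

isPlus-negRevSym : (s : Sym m) → isPlus (negRevSym s) ≡ isMinus s
isPlus-negRevSym plus     = refl
isPlus-negRevSym minus    = refl
isPlus-negRevSym (pair _) = refl

pair-injective : ∀ {i j : Fin m} → pair i ≡ pair j → i ≡ j
pair-injective refl = refl

rightSym≡pair : (x : Maybe (Fin n)) (a : Fin n) → rightSym x ≡ pair (a ↑ˡ n) → x ≡ just a
rightSym≡pair {n} (just b) a e = cong just (FP.↑ˡ-injective n b a (pair-injective e))

leftSym≢pair-↑ˡ : (x : Maybe (Fin n)) (a : Fin n) → leftSym x ≢ pair (a ↑ˡ n)
leftSym≢pair-↑ˡ (just b) a e = ↑ˡ≢opposite-↑ˡ a b (≡-sym (pair-injective e))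

rightSym≢pair-opposite : (x : Maybe (Fin n)) (a : Fin n) → rightSym x ≢ pair (opposite (a ↑ˡ n))
rightSym≢pair-opposite (just b) a e = ↑ˡ≢opposite-↑ˡ b a (pair-injective e)

baseSym-pair : (i j : Fin m) → baseSym i (pair j) ≡ minus → toℕ i < toℕ j
baseSym-pair i j e with toℕ i <ᵇ toℕ j in i<j
baseSym-pair i j e  | true  = <ᵇ⇒< (toℕ i) (toℕ j) (from T-≡ i<j)
baseSym-pair i j () | false

baseSym-leftSym : (a : Fin n) (x : Maybe (Fin n)) → baseSym (a ↑ˡ n) (leftSym x) ≡ minus
baseSym-leftSym a nothing  = refl
baseSym-leftSym a (just b) = cong (if_then minus else plus) (<ᵇ-true (↑ˡ<opposite-↑ˡ a b))

baseSym-rightSym : (a : Fin n) (x : Maybe (Fin n)) → baseSym (opposite (a ↑ˡ n)) (rightSym x) ≡ plus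
baseSym-rightSym a nothing  = refl
baseSym-rightSym a (just b) = cong (if_then minus else plus) (<ᵇ-false (<⇒≤ (↑ˡ<opposite-↑ˡ b a)))

standardBase-↑ˡ : (a : Fin n) → (if toℕ (a ↑ˡ n) <ᵇ n then minus else plus) ≡ minus {n + n}
standardBase-↑ˡ a = cong (if_then minus else plus) (<ᵇ-true (↑ˡ<n a))

standardBase-opposite : (a : Fin n) → (if toℕ (opposite (a ↑ˡ n)) <ᵇ n then minus else plus) ≡ plus {n + n}
standardBase-opposite a = cong (if_then minus else plus) (<ᵇ-false (n≤opposite-↑ˡ a))

skew⇒balanced : (γ : Clan m) → SkewSymmetric γ →
  countF (λ i → isPlus (sym γ i)) ≡ countF (λ i → isMinus (sym γ i))
skew⇒balanced {m} γ skew = trans (sumF-opposite {m} _) (countF-cong λ i → begin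
  isPlus (sym γ (opposite i))                         ≡⟨ cong isPlus (skew (opposite i)) ⟩
  isPlus (negRevSym (sym γ (opposite (opposite i))))  ≡⟨ cong (isPlus ∘ negRevSym ∘ sym γ)
                                                              (FP.opposite-involutive i) ⟩
  isPlus (negRevSym (sym γ i))                        ≡⟨ isPlus-negRevSym (sym γ i) ⟩
  isMinus (sym γ i)                                   ∎)
  where open ≡-Reasoning

IsPartialInvolution : (Fin n → Maybe (Fin n)) → Set
IsPartialInvolution r = ∀ a b → r a ≡ just b → r b ≡ just a

mate : En n → Fin n → Maybe (Fin n)
mate {n} γ a = column (sym (clan γ) (a ↑ˡ n))

En-↑ˡ-opens : (γ : En n) (a : Fin n) {j : Fin (n + n)} →
  sym (clan γ) (a ↑ˡ n) ≡ pair j → toℕ (a ↑ˡ n) < toℕ j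
En-↑ˡ-opens {n} γ a e = baseSym-pair (a ↑ˡ n) _
  (trans (cong (baseSym (a ↑ˡ n)) (≡-sym e)) (trans (base γ (a ↑ˡ n)) (standardBase-↑ˡ a)))

En-sym-↑ˡ : (γ : En n) (a : Fin n) → sym (clan γ) (a ↑ˡ n) ≡ leftSym (mate γ a)
En-sym-↑ˡ {n} γ a = opener (sym (clan γ) (a ↑ˡ n)) refl
  where
  opener : ∀ s → sym (clan γ) (a ↑ˡ n) ≡ s → s ≡ leftSym (column {n} s)
  opener plus e with trans (cong (baseSym (a ↑ˡ n)) (≡-sym e)) (trans (base γ (a ↑ˡ n)) (standardBase-↑ˡ a))
  ... | ()
  opener minus    _ = refl
  opener (pair p) e with half n p
  ... | left b  = ⊥-elim (<-asym (En-↑ˡ-opens γ a e) (En-↑ˡ-opens γ b (pair-sym (clan γ) _ _ e)))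
  ... | right b = cong leftSym (≡-sym (column-leftSym (just b)))

En-sym-opposite : (γ : En n) (a : Fin n) → sym (clan γ) (opposite (a ↑ˡ n)) ≡ rightSym (mate γ a)
En-sym-opposite {n} γ a = begin
  sym (clan γ) (opposite (a ↑ˡ n))                         ≡⟨ skew γ _ ⟩
  negRevSym (sym (clan γ) (opposite (opposite (a ↑ˡ n))))  ≡⟨ cong (negRevSym ∘ sym (clan γ))
                                                                   (FP.opposite-involutive _) ⟩
  negRevSym (sym (clan γ) (a ↑ˡ n))                        ≡⟨ cong negRevSym (En-sym-↑ˡ γ a) ⟩
  negRevSym (leftSym (mate γ a))                           ≡⟨ negRevSym-leftSym (mate γ a) ⟩
  rightSym (mate γ a)                                      ∎
  where open ≡-Reasoning

mate-involutive : (γ : En n) → IsPartialInvolution (mate γ)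
mate-involutive {n} γ a b ab = rightSym≡pair (mate γ b) a (begin
  rightSym (mate γ b)                ≡⟨ En-sym-opposite γ b ⟨
  sym (clan γ) (opposite (b ↑ˡ n))   ≡⟨ pair-sym (clan γ) _ _ (trans (En-sym-↑ˡ γ a) (cong leftSym ab)) ⟩
  pair (a ↑ˡ n)                      ∎)
  where open ≡-Reasoning

En-ext : (γ τ : En n) → (∀ a → mate γ a ≡ mate τ a) → γ ≈E τ
En-ext {n} γ τ h t with half n t
... | left a  = trans (En-sym-↑ˡ γ a) (trans (cong leftSym (h a)) (≡-sym (En-sym-↑ˡ τ a)))
... | right a = trans (En-sym-opposite γ a) (trans (cong rightSym (h a)) (≡-sym (En-sym-opposite τ a)))

partnerSym : (Fin n → Maybe (Fin n)) → Fin (n + n) → Sym (n + n)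
partnerSym {n} r t = [ leftSym ∘ r , rightSym ∘ r ∘ opposite ]′ (splitAt n t)

partnerSym-↑ˡ : (r : Fin n → Maybe (Fin n)) (a : Fin n) → partnerSym r (a ↑ˡ n) ≡ leftSym (r a)
partnerSym-↑ˡ {n} r a rewrite FP.splitAt-↑ˡ n a n = refl

partnerSym-opposite : (r : Fin n → Maybe (Fin n)) (a : Fin n) →
  partnerSym r (opposite (a ↑ˡ n)) ≡ rightSym (r a)
partnerSym-opposite {n} r a
  rewrite opposite-↑ˡ a | FP.splitAt-↑ʳ n n (opposite a) | FP.opposite-involutive a = refl

module _ (r : Fin n → Maybe (Fin n)) (r-inv : IsPartialInvolution r) where

  private
    leftPartner : ∀ a {j} → leftSym (r a) ≡ pair j → partnerSym r j ≡ pair (a ↑ˡ n)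
    leftPartner a e with r a in ra
    leftPartner a refl | just b = trans (partnerSym-opposite r b) (cong rightSym (r-inv a b ra))

    rightPartner : ∀ a {j} → rightSym (r a) ≡ pair j → partnerSym r j ≡ pair (opposite (a ↑ˡ n))
    rightPartner a e with r a in ra
    rightPartner a refl | just b = trans (partnerSym-↑ˡ r b) (cong leftSym (r-inv a b ra))

    partnerSym-pair-sym : ∀ t j → partnerSym r t ≡ pair j → partnerSym r j ≡ pair t
    partnerSym-pair-sym t j e with half n t
    ... | left a  = leftPartner a (trans (≡-sym (partnerSym-↑ˡ r a)) e)
    ... | right a = rightPartner a (trans (≡-sym (partnerSym-opposite r a)) e)

    partnerSym-pair-irr : ∀ t j → partnerSym r t ≡ pair j → t ≢ j
    partnerSym-pair-irr t j e refl with half n t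
    ... | left a  = leftSym≢pair-↑ˡ (r a) a (trans (≡-sym (partnerSym-↑ˡ r a)) e)
    ... | right a = rightSym≢pair-opposite (r a) a (trans (≡-sym (partnerSym-opposite r a)) e)

  partnerClan : Clan (n + n)
  partnerClan = record
    { sym = partnerSym r ; pair-irr = partnerSym-pair-irr ; pair-sym = partnerSym-pair-sym }

  private
    partnerClan-skew : SkewSymmetric partnerClan
    partnerClan-skew t with half n t
    ... | left a = begin
      partnerSym r (a ↑ˡ n)                                   ≡⟨ partnerSym-↑ˡ r a ⟩
      leftSym (r a)                                           ≡⟨ negRevSym-rightSym (r a) ⟨
      negRevSym (rightSym (r a))                              ≡⟨ cong negRevSym (partnerSym-opposite r a) ⟨
      negRevSym (partnerSym r (opposite (a ↑ˡ n)))            ∎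
      where open ≡-Reasoning
    ... | right a = begin
      partnerSym r (opposite (a ↑ˡ n))                        ≡⟨ partnerSym-opposite r a ⟩
      rightSym (r a)                                          ≡⟨ negRevSym-leftSym (r a) ⟨
      negRevSym (leftSym (r a))                               ≡⟨ cong negRevSym (partnerSym-↑ˡ r a) ⟨
      negRevSym (partnerSym r (a ↑ˡ n))                       ≡⟨ cong (negRevSym ∘ partnerSym r)
                                                                      (FP.opposite-involutive _) ⟨
      negRevSym (partnerSym r (opposite (opposite (a ↑ˡ n)))) ∎
      where open ≡-Reasoning

    partnerClan-base : HasStandardBase n partnerClan
    partnerClan-base t with half n t
    ... | left a  = trans (cong (baseSym (a ↑ˡ n)) (partnerSym-↑ˡ r a))
                          (trans (baseSym-leftSym a (r a)) (≡-sym (standardBase-↑ˡ a)))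
    ... | right a = trans (cong (baseSym (opposite (a ↑ˡ n))) (partnerSym-opposite r a))
                          (trans (baseSym-rightSym a (r a)) (≡-sym (standardBase-opposite a)))

  partnerEn : En n
  partnerEn = record
    { clan = partnerClan
    ; nn   = skew⇒balanced partnerClan partnerClan-skew
    ; skew = partnerClan-skew
    ; base = partnerClan-base
    }

  mate-partnerEn : ∀ a → mate partnerEn a ≡ r a
  mate-partnerEn a = trans (cong column (partnerSym-↑ˡ r a)) (column-leftSym (r a))

isPartner : (Fin n → Maybe (Fin n)) → Fin n → Fin n → Bool
isPartner r a b = does (MaybeP.≡-dec FP._≟_ (r a) (just b))

isPartner⇔ : (r : Fin n → Maybe (Fin n)) (a b : Fin n) → isPartner r a b ≡ true ⇔ r a ≡ just b
isPartner⇔ r a b = does≡true⇔ (MaybeP.≡-dec FP._≟_ (r a) (just b))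

isPartner-cong : {r s : Fin n → Maybe (Fin n)} → (∀ a → r a ≡ s a) →
  ∀ a b → isPartner r a b ≡ isPartner s a b
isPartner-cong r≗s a b = cong (λ x → does (MaybeP.≡-dec FP._≟_ x (just b))) (r≗s a)

partnerMatrix : (r : Fin n → Maybe (Fin n)) → IsPartialInvolution r → PartialInvolution n
partnerMatrix r r-inv = record
  { mat    = isPartner r
  ; symm   = isPartner-sym
  ; rowOne = unique
  ; colOne = λ a b c ba ca → unique a b c (trans (isPartner-sym a b) ba) (trans (isPartner-sym a c) ca)
  }
  where
  isPartner-flip : ∀ a b → isPartner r a b ≡ true → isPartner r b a ≡ true
  isPartner-flip a b ab = from (isPartner⇔ r b a) (r-inv a b (to (isPartner⇔ r a b) ab))
  isPartner-sym : ∀ a b → isPartner r a b ≡ isPartner r b a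
  isPartner-sym a b = ⇔→≡ (mk⇔ (isPartner-flip a b) (isPartner-flip b a))
  unique : ∀ a b c → isPartner r a b ≡ true → isPartner r a c ≡ true → b ≡ c
  unique a b c ab ac = just-injective (trans (≡-sym (to (isPartner⇔ r a b) ab)) (to (isPartner⇔ r a c) ac))

partner : PartialInvolution n → Fin n → Maybe (Fin n)
partner π a = Maybe.map proj₁ (dec⇒maybe (any? (λ b → mat π a b Bool.≟ true)))

partner⇔ : (π : PartialInvolution n) (a b : Fin n) → partner π a ≡ just b ⇔ mat π a b ≡ true
partner⇔ π a b = witness⇔ (any? (λ b → mat π a b Bool.≟ true))
  where
  witness⇔ : (d : Dec (∃ λ c → mat π a c ≡ true)) →
    Maybe.map proj₁ (dec⇒maybe d) ≡ just b ⇔ mat π a b ≡ true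
  witness⇔ (yes (c , ac)) = mk⇔ (λ e → subst (λ c → mat π a c ≡ true) (just-injective e) ac)
                                 (λ ab → cong just (rowOne π a c b ac ab))
  witness⇔ (no ∄c)        = mk⇔ (λ ()) (λ ab → ⊥-elim (∄c (b , ab)))

partner-involutive : (π : PartialInvolution n) → IsPartialInvolution (partner π)
partner-involutive π a b ab = from (partner⇔ π b a) (trans (symm π b a) (to (partner⇔ π a b) ab))

partner-partnerMatrix : (r : Fin n → Maybe (Fin n)) (r-inv : IsPartialInvolution r) (a : Fin n) →
  partner (partnerMatrix r r-inv) a ≡ r a
partner-partnerMatrix r r-inv a = just-ext λ b → isPartner⇔ r a b ⇔-∘ partner⇔ (partnerMatrix r r-inv) a b

partner-cong : {π σ : PartialInvolution n} → π ≈P σ → ∀ a → partner π a ≡ partner σ a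
partner-cong {π = π} {σ} π≈σ a = just-ext λ b → mk⇔
  (λ e → from (partner⇔ σ a b) (trans (≡-sym (π≈σ a b)) (to (partner⇔ π a b) e)))
  (λ e → from (partner⇔ π a b) (trans (π≈σ a b) (to (partner⇔ σ a b) e)))

toPI : En n → PartialInvolution n
toPI γ = partnerMatrix (mate γ) (mate-involutive γ)

fromPI : PartialInvolution n → En n
fromPI π = partnerEn (partner π) (partner-involutive π)

toPI-cong : {γ τ : En n} → γ ≈E τ → toPI γ ≈P toPI τ
toPI-cong {n} γ≈τ = isPartner-cong (λ a → cong column (γ≈τ (a ↑ˡ n)))

fromPI-cong : {π σ : PartialInvolution n} → π ≈P σ → fromPI π ≈E fromPI σ
fromPI-cong {π = π} {σ} π≈σ = En-ext (fromPI π) (fromPI σ) λ a → begin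
  mate (fromPI π) a  ≡⟨ mate-partnerEn (partner π) (partner-involutive π) a ⟩
  partner π a        ≡⟨ partner-cong {π = π} {σ} π≈σ a ⟩
  partner σ a        ≡⟨ mate-partnerEn (partner σ) (partner-involutive σ) a ⟨
  mate (fromPI σ) a  ∎
  where open ≡-Reasoning

fromPI-toPI : (γ : En n) → fromPI (toPI γ) ≈E γ
fromPI-toPI γ = En-ext (fromPI (toPI γ)) γ λ a →
  trans (mate-partnerEn _ (partner-involutive (toPI γ)) a) (partner-partnerMatrix (mate γ) (mate-involutive γ) a)

toPI-fromPI : (π : PartialInvolution n) → toPI (fromPI π) ≈P π
toPI-fromPI π a b = trans (isPartner-cong (mate-partnerEn (partner π) (partner-involutive π)) a b)
  (⇔→≡ (partner⇔ π a b ⇔-∘ isPartner⇔ (partner π) a b))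

columnSatisfies : (ℕ → Bool) → Maybe (Fin n) → Bool
columnSatisfies c = maybe′ (c ∘ toℕ) false

columnSatisfies-is-just : (c : ℕ → Bool) → (∀ (b : Fin n) → c (toℕ b) ≡ true) →
  (x : Maybe (Fin n)) → columnSatisfies c x ≡ is-just x
columnSatisfies-is-just c c-true nothing  = refl
columnSatisfies-is-just c c-true (just b) = c-true b

countF-isPartner : (x : Maybe (Fin n)) (X : Bool) (q : Fin n → Bool) →
  countF (λ b → does (MaybeP.≡-dec FP._≟_ x (just b)) ∧ X ∧ q b) ≡
  (if X ∧ maybe′ q false x then 1 else 0)
countF-isPartner {n} nothing X q =
  trans (countF-false {n} λ _ → refl) (cong (if_then 1 else 0) (≡-sym (∧-zeroʳ X)))
countF-isPartner   (just b₀) X q = countF-≟ b₀ (λ b → X ∧ q b)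

rankUL-partnerMatrix : (r : Fin n → Maybe (Fin n)) (r-inv : IsPartialInvolution r) (k l : ℕ) →
  rankUL (partnerMatrix r r-inv) k l ≡ countF (λ a → (toℕ a <ᵇ k) ∧ columnSatisfies (_<ᵇ l) (r a))
rankUL-partnerMatrix r r-inv k l = sumF-cong λ a → countF-isPartner (r a) (toℕ a <ᵇ k) (λ b → toℕ b <ᵇ l)

isMinus-leftSym : (x : Maybe (Fin n)) → isMinus (leftSym x) ≡ is-nothing x
isMinus-leftSym nothing  = refl
isMinus-leftSym (just _) = refl

isMinus-rightSym : (x : Maybe (Fin n)) → isMinus (rightSym x) ≡ false
isMinus-rightSym nothing  = refl
isMinus-rightSym (just _) = refl

isPlus-leftSym : (x : Maybe (Fin n)) → isPlus (leftSym x) ≡ false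
isPlus-leftSym nothing  = refl
isPlus-leftSym (just _) = refl

isPlus-rightSym : (x : Maybe (Fin n)) → isPlus (rightSym x) ≡ is-nothing x
isPlus-rightSym nothing  = refl
isPlus-rightSym (just _) = refl

closesWith-leftSym : (c : ℕ → Bool) (a : Fin n) (x : Maybe (Fin n)) →
  closesWith c (a ↑ˡ n) (leftSym x) ≡ false
closesWith-leftSym     c a nothing  = refl
closesWith-leftSym {n} c a (just b) =
  cong (_∧ c (toℕ (opposite (b ↑ˡ n)))) (<ᵇ-false (<⇒≤ (↑ˡ<opposite-↑ˡ a b)))

closesWith-rightSym : (c : ℕ → Bool) (a : Fin n) (x : Maybe (Fin n)) →
  closesWith c (opposite (a ↑ˡ n)) (rightSym x) ≡ columnSatisfies c x
closesWith-rightSym     c a nothing  = refl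
closesWith-rightSym {n} c a (just b) =
  trans (cong (_∧ c (toℕ (b ↑ˡ n))) (<ᵇ-true (↑ˡ<opposite-↑ˡ b a))) (cong c (FP.toℕ-↑ˡ b n))

countF-En : (γ : En n) (g : Fin (n + n) → Sym (n + n) → Bool) (P : ℕ → Bool) →
  countF (λ t → g t (sym (clan γ) t) ∧ P (toℕ t)) ≡
  countF (λ a → P (toℕ a) ∧ g (a ↑ˡ n) (leftSym (mate γ a))) +
  countF (λ a → P (n + n ∸ suc (toℕ a)) ∧ g (opposite (a ↑ˡ n)) (rightSym (mate γ a)))
countF-En {n} γ g P = trans (countF-halves {n} _) (cong₂ _+_ (countF-cong at-↑ˡ) (countF-cong at-opposite))
  where
  at-↑ˡ : ∀ a → g (a ↑ˡ n) (sym (clan γ) (a ↑ˡ n)) ∧ P (toℕ (a ↑ˡ n)) ≡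
                P (toℕ a) ∧ g (a ↑ˡ n) (leftSym (mate γ a))
  at-↑ˡ a = trans (cong₂ _∧_ (cong (g (a ↑ˡ n)) (En-sym-↑ˡ γ a)) (cong P (FP.toℕ-↑ˡ a n)))
                  (∧-comm (g (a ↑ˡ n) (leftSym (mate γ a))) (P (toℕ a)))
  at-opposite : ∀ a →
    g (opposite (a ↑ˡ n)) (sym (clan γ) (opposite (a ↑ˡ n))) ∧ P (toℕ (opposite (a ↑ˡ n))) ≡
    P (n + n ∸ suc (toℕ a)) ∧ g (opposite (a ↑ˡ n)) (rightSym (mate γ a))
  at-opposite a =
    trans (cong₂ _∧_ (cong (g (opposite (a ↑ˡ n))) (En-sym-opposite γ a)) (cong P (toℕ-opposite-↑ˡ a)))
          (∧-comm (g (opposite (a ↑ˡ n)) (rightSym (mate γ a))) (P (n + n ∸ suc (toℕ a))))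

countF-isMinus : (γ : En n) (P : ℕ → Bool) →
  countF (λ t → isMinus (sym (clan γ) t) ∧ P (toℕ t)) ≡ countF (λ a → P (toℕ a) ∧ is-nothing (mate γ a))
countF-isMinus γ P = begin
  countF (λ t → isMinus (sym (clan γ) t) ∧ P (toℕ t))
    ≡⟨ countF-En γ (const isMinus) P ⟩
  countF (λ a → P (toℕ a) ∧ isMinus (leftSym (mate γ a))) + countF (λ a → _ ∧ isMinus (rightSym (mate γ a)))
    ≡⟨ cong₂ _+_ (countF-cong λ a → cong (P (toℕ a) ∧_) (isMinus-leftSym (mate γ a)))
                 (countF-false λ a → trans (cong (_ ∧_) (isMinus-rightSym (mate γ a))) (∧-zeroʳ _)) ⟩
  countF (λ a → P (toℕ a) ∧ is-nothing (mate γ a)) + 0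
    ≡⟨ +-identityʳ _ ⟩
  countF (λ a → P (toℕ a) ∧ is-nothing (mate γ a))  ∎
  where open ≡-Reasoning

countF-isPlus : (γ : En n) (P : ℕ → Bool) →
  countF (λ t → isPlus (sym (clan γ) t) ∧ P (toℕ t)) ≡
  countF (λ a → P (n + n ∸ suc (toℕ a)) ∧ is-nothing (mate γ a))
countF-isPlus {n} γ P = begin
  countF (λ t → isPlus (sym (clan γ) t) ∧ P (toℕ t))
    ≡⟨ countF-En γ (const isPlus) P ⟩
  countF (λ a → _ ∧ isPlus (leftSym (mate γ a))) +
  countF (λ a → P (n + n ∸ suc (toℕ a)) ∧ isPlus (rightSym (mate γ a)))
    ≡⟨ cong₂ _+_ (countF-false λ a → trans (cong (_ ∧_) (isPlus-leftSym (mate γ a))) (∧-zeroʳ _))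
                 (countF-cong λ a → cong (_ ∧_) (isPlus-rightSym (mate γ a))) ⟩
  countF (λ a → P (n + n ∸ suc (toℕ a)) ∧ is-nothing (mate γ a))  ∎
  where open ≡-Reasoning

countF-closesWith : (γ : En n) (c P : ℕ → Bool) →
  countF (λ t → closesWith c t (sym (clan γ) t) ∧ P (toℕ t)) ≡
  countF (λ a → P (n + n ∸ suc (toℕ a)) ∧ columnSatisfies c (mate γ a))
countF-closesWith {n} γ c P = begin
  countF (λ t → closesWith c t (sym (clan γ) t) ∧ P (toℕ t))
    ≡⟨ countF-En γ (closesWith c) P ⟩
  countF (λ a → _ ∧ closesWith c (a ↑ˡ n) (leftSym (mate γ a))) +
  countF (λ a → P (n + n ∸ suc (toℕ a)) ∧ closesWith c (opposite (a ↑ˡ n)) (rightSym (mate γ a)))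
    ≡⟨ cong₂ _+_ (countF-false λ a → trans (cong (_ ∧_) (closesWith-leftSym c a (mate γ a))) (∧-zeroʳ _))
                 (countF-cong λ a → cong (_ ∧_) (closesWith-rightSym c a (mate γ a))) ⟩
  countF (λ a → P (n + n ∸ suc (toℕ a)) ∧ columnSatisfies c (mate γ a))  ∎
  where open ≡-Reasoning

pairsUpTo-En : (γ : En n) (i : ℕ) →
  pairsUpTo (clan γ) i ≡ countF (λ a → (n + n ∸ suc (toℕ a) <ᵇ i) ∧ is-just (mate γ a))
pairsUpTo-En γ i = trans (countF-closesWith γ (const true) (_<ᵇ i))
  (countF-cong λ a → cong (_ ∧_) (columnSatisfies-is-just (const true) (λ _ → refl) (mate γ a)))

rankUL-En : (γ : En n) (k : ℕ) → rankUL (toPI γ) k n ≡ countF (λ a → (toℕ a <ᵇ k) ∧ is-just (mate γ a))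
rankUL-En {n} γ k = trans (rankUL-partnerMatrix (mate γ) (mate-involutive γ) k n)
  (countF-cong λ a → cong (_ ∧_) (columnSatisfies-is-just (_<ᵇ n) (<ᵇ-true ∘ FP.toℕ<n) (mate γ a)))

plusCount-En : (γ : En n) (i : ℕ) → plusCount (clan γ) i ≡ countF {n} (λ a → n + n ∸ suc (toℕ a) <ᵇ i)
plusCount-En {n} γ i = trans (cong₂ _+_ (countF-isPlus γ (_<ᵇ i)) (pairsUpTo-En γ i))
  (countF-partition (λ a → n + n ∸ suc (toℕ a) <ᵇ i) (is-just ∘ mate γ))

minusCount+rankUL : (γ : En n) (i : ℕ) → i ≤ n → minusCount (clan γ) i + rankUL (toPI γ) i n ≡ i
minusCount+rankUL {n} γ i i≤n = begin
  minusCount (clan γ) i + rankUL (toPI γ) i n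
    ≡⟨ cong₂ _+_ (cong₂ _+_ (countF-isMinus γ (_<ᵇ i)) (pairsUpTo-En γ i)) (rankUL-En γ i) ⟩
  (unpaired + countF (λ a → (n + n ∸ suc (toℕ a) <ᵇ i) ∧ is-just (mate γ a))) + paired
    ≡⟨ cong (λ x → (unpaired + x) + paired) (countF-false λ a →
         cong (_∧ is-just (mate γ a)) (<ᵇ-false (≤-trans i≤n (n≤n+n∸suc (FP.toℕ<n a))))) ⟩
  (unpaired + 0) + paired
    ≡⟨ cong (_+ paired) (+-identityʳ unpaired) ⟩
  unpaired + paired
    ≡⟨ countF-partition (λ a → toℕ a <ᵇ i) (is-just ∘ mate γ) ⟩
  countF {n} (λ a → toℕ a <ᵇ i)
    ≡⟨ countF-<ᵇ i i≤n ⟩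
  i  ∎
  where
  open ≡-Reasoning
  unpaired paired : ℕ
  unpaired = countF (λ a → (toℕ a <ᵇ i) ∧ not (is-just (mate γ a)))
  paired   = countF (λ a → (toℕ a <ᵇ i) ∧ is-just (mate γ a))

minusCount+rankUL-upper : (γ : En n) (i : ℕ) → i ≤ n →
  minusCount (clan γ) (n + i) + rankUL (toPI γ) (n ∸ i) n ≡ n
minusCount+rankUL-upper {n} γ i i≤n = begin
  minusCount (clan γ) (n + i) + rankUL (toPI γ) (n ∸ i) n
    ≡⟨ cong₂ _+_ (cong₂ _+_ (countF-isMinus γ (_<ᵇ n + i)) (pairsUpTo-En γ (n + i)))
                 (rankUL-En γ (n ∸ i)) ⟩
  (countF (λ a → (toℕ a <ᵇ n + i) ∧ not (is-just (mate γ a))) +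
   countF (λ a → (n + n ∸ suc (toℕ a) <ᵇ n + i) ∧ is-just (mate γ a))) +
  countF (λ a → a<n∸i a ∧ is-just (mate γ a))
    ≡⟨ cong₂ _+_ (cong₂ _+_ (countF-cong opens-before) (countF-cong closes-before))
                 (countF-cong λ a → ∧-comm (a<n∸i a) (is-just (mate γ a))) ⟩
  (unpaired + paired≥) + paired<
    ≡⟨ +-assoc unpaired paired≥ paired< ⟩
  unpaired + (paired≥ + paired<)
    ≡⟨ cong (unpaired +_) (countF-partition (is-just ∘ mate γ) a<n∸i) ⟩
  unpaired + countF (λ a → is-just (mate γ a))
    ≡⟨ countF-partition (const true) (is-just ∘ mate γ) ⟩
  countF {n} (const true)
    ≡⟨ countF-true ⟩
  n  ∎
  where
  open ≡-Reasoning
  a<n∸i : Fin n → Bool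
  a<n∸i a = toℕ a <ᵇ n ∸ i
  unpaired paired≥ paired< : ℕ
  unpaired = countF (λ a → not (is-just (mate γ a)))
  paired≥  = countF (λ a → is-just (mate γ a) ∧ not (a<n∸i a))
  paired<  = countF (λ a → is-just (mate γ a) ∧ a<n∸i a)
  opens-before : ∀ a → (toℕ a <ᵇ n + i) ∧ not (is-just (mate γ a)) ≡ not (is-just (mate γ a))
  opens-before a = cong (_∧ not (is-just (mate γ a))) (<ᵇ-true (≤-trans (FP.toℕ<n a) (m≤m+n n i)))
  closes-before : ∀ a → (n + n ∸ suc (toℕ a) <ᵇ n + i) ∧ is-just (mate γ a) ≡
                        is-just (mate γ a) ∧ not (a<n∸i a)
  closes-before a = trans
    (cong (_∧ is-just (mate γ a))
          (trans (∸-<ᵇ-swap (+-monoʳ-≤ n i≤n) (≤-trans (FP.toℕ<n a) (m≤m+n n n)))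
                 (cong (λ k → not (toℕ a <ᵇ k)) ([m+n]∸[m+o]≡n∸o n n i))))
    (∧-comm (not (a<n∸i a)) (is-just (mate γ a)))

crossCount≡rankUL : (γ : En n) (i j : ℕ) → j ≤ n + n →
  crossCount (clan γ) i j ≡ rankUL (toPI γ) (n + n ∸ j) i
crossCount≡rankUL {n} γ i j j≤2n = begin
  crossCount (clan γ) i j
    ≡⟨ countF-closesWith γ (_<ᵇ i) (j ≤ᵇ_) ⟩
  countF (λ a → (j ≤ᵇ n + n ∸ suc (toℕ a)) ∧ columnSatisfies (_<ᵇ i) (mate γ a))
    ≡⟨ countF-cong (λ a → cong (_∧ columnSatisfies (_<ᵇ i) (mate γ a))
                              (≤ᵇ-∸-swap j≤2n (≤-trans (FP.toℕ<n a) (m≤m+n n n)))) ⟩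
  countF (λ a → (toℕ a <ᵇ n + n ∸ j) ∧ columnSatisfies (_<ᵇ i) (mate γ a))
    ≡⟨ rankUL-partnerMatrix (mate γ) (mate-involutive γ) (n + n ∸ j) i ⟨
  rankUL (toPI γ) (n + n ∸ j) i  ∎
  where open ≡-Reasoning

rankUL-zeroˡ : (π : PartialInvolution n) (l : ℕ) → rankUL π 0 l ≡ 0
rankUL-zeroˡ π l = sumF-zero λ a → countF-false λ b → ∧-zeroʳ (mat π a b)

rankUL-zeroʳ : (π : PartialInvolution n) (k : ℕ) → rankUL π k 0 ≡ 0
rankUL-zeroʳ π k = sumF-zero λ a → countF-false λ b →
  trans (cong (mat π a b ∧_) (∧-zeroʳ (toℕ a <ᵇ k))) (∧-zeroʳ (mat π a b))

<ᵇ-⊓ : (a : Fin n) (k : ℕ) → (toℕ a <ᵇ k) ≡ (toℕ a <ᵇ k ⊓ n)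
<ᵇ-⊓ {n} a k = does-⇔
  (mk⇔ (λ a<k → ⊓-glb a<k (FP.toℕ<n a)) (λ a<k⊓n → <-≤-trans a<k⊓n (m⊓n≤m k n)))
  (_ <? _) (_ <? _)

rankUL-⊓ : (π : PartialInvolution n) (k l : ℕ) → rankUL π k l ≡ rankUL π (k ⊓ n) (l ⊓ n)
rankUL-⊓ π k l = sumF-cong λ a → countF-cong λ b →
  cong₂ (λ x y → mat π a b ∧ x ∧ y) (<ᵇ-⊓ a k) (<ᵇ-⊓ b l)

≼⇒rankUL-≤ : {π σ : PartialInvolution n} → π ≼ σ → ∀ k l → rankUL π k l ≤ rankUL σ k l
≼⇒rankUL-≤ {n} {π} {σ} π≼σ k l = subst₂ _≤_ (≡-sym (rankUL-⊓ π k l)) (≡-sym (rankUL-⊓ σ k l))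
  (bounded (k ⊓ n) (l ⊓ n) (m⊓n≤n k n) (m⊓n≤n l n))
  where
  bounded : ∀ k l → k ≤ n → l ≤ n → rankUL π k l ≤ rankUL σ k l
  bounded zero    l       _   _   = ≤-reflexive (trans (rankUL-zeroˡ π l) (≡-sym (rankUL-zeroˡ σ l)))
  bounded (suc k) zero    _   _   = ≤-reflexive (trans (rankUL-zeroʳ π (suc k)) (≡-sym (rankUL-zeroʳ σ (suc k))))
  bounded (suc k) (suc l) k≤n l≤n = π≼σ (suc k) (suc l) (s≤s z≤n) k≤n (s≤s z≤n) l≤n

≤C⇒≼ : {γ τ : En n} → γ ≤C τ → toPI γ ≼ toPI τ
≤C⇒≼ {n} {γ} {τ} (_ , minus≥ , cross≤) k l 1≤k k≤n 1≤l l≤n with m≤n⇒m<n∨m≡n l≤n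
... | inj₁ l<n = subst₂ _≤_ (crossCount-rankUL γ) (crossCount-rankUL τ)
  (cross≤ l (n + n ∸ k) 1≤l (<-≤-trans l<n (m+n≤o⇒m≤o∸n n (+-monoʳ-≤ n k≤n))) (m∸n≤m (n + n) k))
  where
  crossCount-rankUL : ∀ δ → crossCount (clan δ) l (n + n ∸ k) ≡ rankUL (toPI δ) k l
  crossCount-rankUL δ = trans (crossCount≡rankUL δ l (n + n ∸ k) (m∸n≤m (n + n) k))
    (cong (λ k′ → rankUL (toPI δ) k′ l) (m∸[m∸n]≡n (≤-trans k≤n (m≤m+n n n))))
... | inj₂ refl = to (≤-complement (minusCount+rankUL γ k k≤n) (minusCount+rankUL τ k k≤n))
  (minus≥ k 1≤k (≤-trans k≤n (m≤m+n n n)))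

≼⇒≤C : {γ τ : En n} → toPI γ ≼ toPI τ → γ ≤C τ
≼⇒≤C {n} {γ} {τ} γ≼τ = plus≥ , minus≥ , cross≤
  where
  rank≤ : ∀ k l → rankUL (toPI γ) k l ≤ rankUL (toPI τ) k l
  rank≤ = ≼⇒rankUL-≤ {π = toPI γ} {toPI τ} γ≼τ
  plus≥ : ∀ i → 1 ≤ i → i ≤ n + n → plusCount (clan τ) i ≤ plusCount (clan γ) i
  plus≥ i _ _ = ≤-reflexive (trans (plusCount-En τ i) (≡-sym (plusCount-En γ i)))
  minus≥ : ∀ i → 1 ≤ i → i ≤ n + n → minusCount (clan τ) i ≤ minusCount (clan γ) i
  minus≥ i _ i≤2n with ≤-total i n
  ... | inj₁ i≤n = from (≤-complement (minusCount+rankUL γ i i≤n) (minusCount+rankUL τ i i≤n)) (rank≤ i n)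
  ... | inj₂ n≤i = subst (λ i → minusCount (clan τ) i ≤ minusCount (clan γ) i) (m+[n∸m]≡n n≤i)
    (from (≤-complement (minusCount+rankUL-upper γ (i ∸ n) i∸n≤n)
                        (minusCount+rankUL-upper τ (i ∸ n) i∸n≤n))
          (rank≤ (n ∸ (i ∸ n)) n))
    where
    i∸n≤n : i ∸ n ≤ n
    i∸n≤n = m≤n+o⇒m∸n≤o i n i≤2n
  cross≤ : ∀ i j → 1 ≤ i → i < j → j ≤ n + n → crossCount (clan γ) i j ≤ crossCount (clan τ) i j
  cross≤ i j _ _ j≤2n = subst₂ _≤_ (≡-sym (crossCount≡rankUL γ i j j≤2n)) (≡-sym (crossCount≡rankUL τ i j j≤2n))
    (rank≤ (n + n ∸ j) i)

theorem6p9 : (n : ℕ) → 1 ≤ n →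
    PosetIso (En n) _≈E_ _≤C_ (PartialInvolution n) _≈P_ _≼_
theorem6p9 n _ = record
  { to        = toPI
  ; from      = fromPI
  ; to-cong   = λ {γ} {τ} → toPI-cong {γ = γ} {τ}
  ; from-cong = λ {π} {σ} → fromPI-cong {π = π} {σ}
  ; from-to   = fromPI-toPI
  ; to-from   = toPI-fromPI
  ; mono      = λ γ τ → mk⇔ (≤C⇒≼ {γ = γ} {τ}) (≼⇒≤C {γ = γ} {τ})
  }
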